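{- Let $G=(V,E)$ be a DAG with maximum out-degree $d_{out}$ and topological depth $\ell$. Then for every visit rule $r$ of $G$ there exists an $r$-visit $\psi$ of $G$ such that $b_r(\psi)\leq (d_{out}-1)\ell+1$.
   Context: For a vertex $v$ of a finite DAG $G=(V,E)$, $\mathrm{pred}(v)=\{u : (u,v)\in E\}$ and $\mathrm{suc}(v)=\{u : (v,u)\in E\}$; the maximum out-degree is $\max_v|\mathrm{suc}(v)|$. The topological depth of $G$ is the number of edges of a longest directed path in $G$. A visit rule $r$ for $G$ assigns to each $v\in V$ a non-empty family $r(v)$ of subsets of $\mathrm{pred}(v)$, called enablers of $v$. An $r$-sequence is a sequence $\psi$ of distinct vertices such that for every $1\le i\le|\psi|$ the set of vertices of the prefix $\psi[1..i-1]$ contains some enabler $Q\in r(\psi[i])$. An $r$-visit is an $r$-sequence containing all $|V|$ vertices. The $r$-boundary of an $r$-sequence $\psi$ is $B_r(\psi)=\{v\in V\setminus\psi : \exists Q\neq\emptyset,\ Q\in r(v),\ Q\subseteq\psi\}$, and $b_r(\psi)=\max_{1\le i\le|\psi|}|B_r(\psi[1..i])|$. -}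

module Defs where

open import Data.Nat using (ℕ; zero; suc; _+_; _*_; _∸_; _≤_; _<_; _⊔_)
open import Data.Fin using (Fin)
open import Data.Fin.Subset using (Subset; _∈_; _∉_; _⊆_; Nonempty; ⋃; ⁅_⁆; ∣_∣)
open import Data.Fin.Subset.Properties using (_∈?_; _⊆?_; nonempty?)
open import Data.List using (List; []; _∷_; length; take; map; foldr; lookup; allFin)
import Data.List.Membership.Propositional as LM
open import Data.List.Relation.Unary.Any using (Any; any?)
open import Data.List.Relation.Unary.Unique.Propositional using (Unique)
open import Data.Vec using (tabulate)
open import Data.Product using (Σ; ∃; _×_; _,_)
open import Data.Sum using (_⊎_)
open import Relation.Nullary using (¬_; Dec; does)
open import Relation.Nullary.Decidable using (_×-dec_; ¬?)
open import Relation.Binary.PropositionalEquality using (_≡_; _≢_)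

Graph : ℕ → Set
Graph n = Fin n → Subset n

module _ {n : ℕ} (G : Graph n) where

  Edge : Fin n → Fin n → Set
  Edge u v = v ∈ G u

  data Path : Fin n → Fin n → ℕ → Set where
    here : ∀ {u} → Path u u 0
    step : ∀ {u w v k} → Edge u w → Path w v k → Path u v (suc k)

  IsDAG : Set
  IsDAG = ∀ v k → ¬ Path v v (suc k)

  maxOutDeg : ℕ
  maxOutDeg = foldr _⊔_ 0 (map (λ v → ∣ G v ∣) (allFin n))

  -- topological depth: number of edges of a longest directed path
  -- (ℓ = 0 allowed only as the convention for the empty graph / or realized by a 0-edge path)
  IsDepth : ℕ → Set
  IsDepth ℓ = (∀ u v k → Path u v k → k ≤ ℓ)
            × (ℓ ≡ 0 ⊎ Σ (Fin n) λ u → Σ (Fin n) λ v → Path u v ℓ)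

-- A visit rule: every vertex gets a finite family (list) of enablers.
Rule : ℕ → Set
Rule n = Fin n → List (Subset n)

module _ {n : ℕ} (G : Graph n) where

  IsVisitRule : Rule n → Set
  IsVisitRule r = ∀ v → (r v ≢ []) × (∀ Q → Q LM.∈ r v → ∀ u → u ∈ Q → Edge G u v)

setOf : ∀ {n} → List (Fin n) → Subset n
setOf ψ = ⋃ (map ⁅_⁆ ψ)

IsRSeq : ∀ {n} → Rule n → List (Fin n) → Set
IsRSeq r ψ = Unique ψ ×
  (∀ i → Σ (Subset _) λ Q → Q LM.∈ r (lookup ψ i) × Q ⊆ setOf (take (Data.Fin.toℕ i) ψ))

IsRVisit : ∀ {n} → Rule n → List (Fin n) → Set
IsRVisit {n} r ψ = IsRSeq r ψ × (length ψ ≡ n)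

InBoundary : ∀ {n} → Rule n → Subset n → Fin n → Set
InBoundary r S v = v ∉ S × Any (λ Q → Nonempty Q × Q ⊆ S) (r v)

inBoundary? : ∀ {n} (r : Rule n) (S : Subset n) (v : Fin n) → Dec (InBoundary r S v)
inBoundary? r S v = ¬? (v ∈? S) ×-dec any? (λ Q → nonempty? Q ×-dec (Q ⊆? S)) (r v)

boundary : ∀ {n} → Rule n → List (Fin n) → Subset n
boundary r ψ = tabulate (λ v → does (inBoundary? r (setOf ψ) v))

bnum : ∀ {n} → Rule n → List (Fin n) → ℕ
bnum r ψ = foldr _⊔_ 0 (map (λ i → ∣ boundary r (take i ψ) ∣) (map suc (Data.List.upTo (length ψ))))

{-# OPTIONS --safe #-}
-- Let h v be the length of a longest path starting at v, so that h drops along every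
-- edge and never exceeds ℓ.  Visit greedily: while the boundary is non-empty, visit a
-- boundary vertex v of least height; otherwise visit an unvisited vertex of greatest
-- height, whose predecessors, being higher, are all visited already.  With
-- c = d_out - 1 the invariant is that for every t at most c (ℓ - t) + 1 boundary
-- vertices have height ≥ t.  Visiting v removes v from the boundary and adds at most
-- c + 1 successors of v, all lower than v.  So the count at levels t ≥ h v does not
-- grow, while for t < h v (all boundary vertices having height ≥ h v) it becomes at
-- most c (ℓ - h v) + (c + 1) ≤ c (ℓ - t) + 1.  At t = 0 this is the claimed bound.
module Submission where

open import Defs
open import Level using (0ℓ)
open import Data.Nat using (ℕ; zero; suc; _+_; _*_; _∸_; _≤_; _<_; _⊔_; z≤n; s≤s; s≤s⁻¹; z<s; _≤?_; >-nonZero)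
open import Data.Nat.Properties
open import Data.Fin as Fin using (Fin; toℕ)
open import Data.Fin.Properties using (any?; ¬∀⟶∃¬)
open import Data.Fin.Subset
  using (Subset; _∈_; _∉_; _⊆_; _⊂_; Empty; ⁅_⁆; ∣_∣; _∪_; _∩_; _-_; ⊥; ⊤; inside; outside)
open import Data.Fin.Subset.Properties
open import Data.Vec using ([]; _∷_; tabulate)
open import Data.Vec.Properties using (lookup∘tabulate; []=⇒lookup; lookup⇒[]=)
open import Data.List using (List; []; _∷_; length; take; map; foldr; lookup; upTo)
open import Data.List.Properties using (foldr-preservesᵇ; foldr-preservesᵒ)
import Data.List.Membership.Propositional as LM
open import Data.List.Membership.Propositional.Properties using (∈-map⁺; ∈-allFin)
open import Data.List.Relation.Unary.Any as Any using (Any)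
open import Data.List.Relation.Unary.All as All using (All; []; _∷_)
open import Data.List.Relation.Unary.All.Properties as All using ()
open import Data.List.Relation.Unary.Unique.Propositional using (Unique)
open import Data.List.Relation.Unary.AllPairs using ([]; _∷_)
open import Data.Product using (Σ; ∃; _×_; _,_; proj₁; proj₂)
open import Data.Sum using (_⊎_; inj₁; inj₂; [_,_])
open import Relation.Nullary using (Dec; yes; no; does; contradiction; ¬?)
open import Relation.Nullary.Decidable using (dec-true; _×-dec_)
open import Relation.Unary using (Pred; Decidable)
open import Relation.Binary.PropositionalEquality using (_≡_; _≢_; refl; sym; trans; cong; subst)

module _ {n : ℕ} {P : Pred (Fin n) 0ℓ} (P? : Decidable P) where

  subsetOf : Subset n
  subsetOf = tabulate (λ x → does (P? x))

  ∈-subsetOf⁺ : ∀ {x} → P x → x ∈ subsetOf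
  ∈-subsetOf⁺ {x} px = lookup⇒[]= x subsetOf (trans (lookup∘tabulate _ x) (dec-true (P? x) px))

  ∈-subsetOf⁻ : ∀ {x} → x ∈ subsetOf → P x
  ∈-subsetOf⁻ {x} x∈ with P? x | trans (sym (lookup∘tabulate _ x)) ([]=⇒lookup x∈)
  ... | yes px | _  = px
  ... | no  _  | ()

∣Empty∣≡0 : ∀ {n} {p : Subset n} → Empty p → ∣ p ∣ ≡ 0
∣Empty∣≡0 {n} empty = trans (cong ∣_∣ (Empty-unique empty)) (∣⊥∣≡0 n)

∣p∪q∣≤∣p∣+∣q∣ : ∀ {n} (p q : Subset n) → ∣ p ∪ q ∣ ≤ ∣ p ∣ + ∣ q ∣
∣p∪q∣≤∣p∣+∣q∣ []            []            = z≤n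
∣p∪q∣≤∣p∣+∣q∣ (inside  ∷ p) (inside  ∷ q) = s≤s (≤-trans (∣p∪q∣≤∣p∣+∣q∣ p q) (+-monoʳ-≤ ∣ p ∣ (n≤1+n ∣ q ∣)))
∣p∪q∣≤∣p∣+∣q∣ (inside  ∷ p) (outside ∷ q) = s≤s (∣p∪q∣≤∣p∣+∣q∣ p q)
∣p∪q∣≤∣p∣+∣q∣ (outside ∷ p) (inside  ∷ q) = ≤-trans (s≤s (∣p∪q∣≤∣p∣+∣q∣ p q)) (≤-reflexive (sym (+-suc ∣ p ∣ ∣ q ∣)))
∣p∪q∣≤∣p∣+∣q∣ (outside ∷ p) (outside ∷ q) = ∣p∪q∣≤∣p∣+∣q∣ p q

x∉p⇒∣p∪⁅x⁆∣≡1+∣p∣ : ∀ {n} {p : Subset n} {x} → x ∉ p → ∣ p ∪ ⁅ x ⁆ ∣ ≡ suc ∣ p ∣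
x∉p⇒∣p∪⁅x⁆∣≡1+∣p∣ {p = p} {x} x∉p = ≤-antisym upper (p⊂q⇒∣p∣<∣q∣ p⊂p∪⁅x⁆)
  where
  upper : ∣ p ∪ ⁅ x ⁆ ∣ ≤ suc ∣ p ∣
  upper = ≤-trans (∣p∪q∣≤∣p∣+∣q∣ p ⁅ x ⁆) (≤-reflexive (trans (cong (∣ p ∣ +_) (∣⁅x⁆∣≡1 x)) (+-comm ∣ p ∣ 1)))
  p⊂p∪⁅x⁆ : p ⊂ p ∪ ⁅ x ⁆
  p⊂p∪⁅x⁆ = p⊆p∪q ⁅ x ⁆ , x , x∈p∪q⁺ (inj₂ (x∈⁅x⁆ x)) , x∉p

∣p∣<n⇒∃∉ : ∀ {n} (p : Subset n) → ∣ p ∣ < n → ∃ λ x → x ∉ p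
∣p∣<n⇒∃∉ {n} p ∣p∣<n = ¬∀⟶∃¬ n (_∈ p) (_∈? p) λ all∈ →
  <⇒≱ ∣p∣<n (subst (_≤ ∣ p ∣) (∣⊤∣≡n n) (p⊆q⇒∣p∣≤∣q∣ {p = ⊤} (λ {x} _ → all∈ x)))

minimiser : ∀ {n} {P : Pred (Fin n) 0ℓ} → Decidable P → (f : Fin n → ℕ) → ∀ {v} → P v →
            Σ (Fin n) λ u → P u × (∀ {w} → P w → f u ≤ f w)
minimiser {n} {P} P? f {v} pv = search (f v) pv ≤-refl
  where
  search : ∀ m {v} → P v → f v ≤ m → Σ (Fin n) λ u → P u × (∀ {w} → P w → f u ≤ f w)
  search zero    {v} pv fv≤0 = v , pv , λ _ → ≤-trans fv≤0 z≤n
  search (suc m) {v} pv fv≤m with any? (λ w → P? w ×-dec (f w ≤? m))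
  ... | yes (w , pw , fw≤m) = search m pw fw≤m
  ... | no  none            = v , pv , λ {w} pw → ≤-trans fv≤m (≰⇒> λ fw≤m → none (w , pw , fw≤m))

foldr-⊔-map-≤ : ∀ {K} (f : ℕ → ℕ) → (∀ i → f i ≤ K) → ∀ xs → foldr _⊔_ 0 (map f xs) ≤ K
foldr-⊔-map-≤ {K} f f≤K xs = foldr-preservesᵇ {P = _≤ K} ⊔-lub z≤n (All.map⁺ (All.universal f≤K xs))

outDeg≤maxOutDeg : ∀ {n} (G : Graph n) v → ∣ G v ∣ ≤ maxOutDeg G
outDeg≤maxOutDeg {n} G v = foldr-preservesᵒ {P = ∣ G v ∣ ≤_} ≤-⊔ 0 _
  (inj₂ (Any.map ≤-reflexive (∈-map⁺ (λ u → ∣ G u ∣) (∈-allFin v))))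
  where
  ≤-⊔ : ∀ x y → ∣ G v ∣ ≤ x ⊎ ∣ G v ∣ ≤ y → ∣ G v ∣ ≤ x ⊔ y
  ≤-⊔ x y = [ m≤n⇒m≤n⊔o y , m≤n⇒m≤o⊔n x ]

record GreatestBelow (P : ℕ → Set) (m : ℕ) : Set where
  field
    value    : ℕ
    value≤   : value ≤ m
    holds    : P value
    greatest : ∀ {k} → k ≤ m → P k → k ≤ value

greatestBelow : ∀ {P : ℕ → Set} → (∀ k → Dec (P k)) → P 0 → ∀ m → GreatestBelow P m
greatestBelow P? p0 zero = record { value = 0 ; value≤ = z≤n ; holds = p0 ; greatest = λ k≤0 _ → k≤0 }
greatestBelow {P} P? p0 (suc m) with P? (suc m)
... | yes pm = record { value = suc m ; value≤ = ≤-refl ; holds = pm ; greatest = λ k≤ _ → k≤ }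
... | no ¬pm = record { value = value ; value≤ = m≤n⇒m≤1+n value≤ ; holds = holds ; greatest = greatest′ }
  where
  open GreatestBelow (greatestBelow P? p0 m)
  greatest′ : ∀ {k} → k ≤ suc m → P k → k ≤ value
  greatest′ k≤ pk with m≤n⇒m<n∨m≡n k≤
  ... | inj₁ k<   = greatest (s≤s⁻¹ k<) pk
  ... | inj₂ refl = contradiction pk ¬pm

module Height {n : ℕ} (G : Graph n) (ℓ : ℕ) (pathsBounded : ∀ u v k → Path G u v k → k ≤ ℓ) where

  PathFrom : Fin n → ℕ → Set
  PathFrom v k = ∃ λ x → Path G v x k

  pathFrom? : ∀ v k → Dec (PathFrom v k)
  pathFrom? v zero    = yes (v , here)
  pathFrom? v (suc k) with any? (λ w → (w ∈? G v) ×-dec pathFrom? w k)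
  ... | yes (w , e , x , p) = yes (x , step e p)
  ... | no  none            = no λ { (x , step {w = w} e p) → none (w , e , x , p) }

  longest : ∀ v → GreatestBelow (PathFrom v) ℓ
  longest v = greatestBelow (pathFrom? v) (v , here) ℓ

  height : Fin n → ℕ
  height v = GreatestBelow.value (longest v)

  height≤ℓ : ∀ v → height v ≤ ℓ
  height≤ℓ v = GreatestBelow.value≤ (longest v)

  height-edge : ∀ {u w} → Edge G u w → height w < height u
  height-edge {u} {w} e with GreatestBelow.holds (longest w)
  ... | x , p = GreatestBelow.greatest (longest u) (pathsBounded u x _ (step e p)) (x , step e p)

EnabledBy : ∀ {n} → Rule n → Subset n → Fin n → Set
EnabledBy r S v = Σ (Subset _) λ Q → Q LM.∈ r v × Q ⊆ S

boundaryOf : ∀ {n} → Rule n → Subset n → Subset n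
boundaryOf r S = subsetOf (inBoundary? r S)

module _ {n : ℕ} (r : Rule n) where

  boundary⇒enabled : ∀ {S v} → v ∈ boundaryOf r S → v ∉ S × EnabledBy r S v
  boundary⇒enabled v∈ with ∈-subsetOf⁻ (inBoundary? r _) v∈
  ... | v∉S , enablers with LM.find enablers
  ... | Q , Q∈ , _ , Q⊆S = v∉S , Q , Q∈ , Q⊆S

  boundary-⊥ : Empty (boundaryOf r ⊥)
  boundary-⊥ (v , v∈) with LM.find (proj₂ (∈-subsetOf⁻ (inBoundary? r ⊥) v∈))
  ... | Q , _ , (u , u∈Q) , Q⊆⊥ = ∉⊥ (Q⊆⊥ u∈Q)

module _ {n : ℕ} {G : Graph n} {r : Rule n} (isRule : IsVisitRule G r) where

  boundary-∪⁅⁆ : ∀ S v → boundaryOf r (S ∪ ⁅ v ⁆) ⊆ (boundaryOf r S - v) ∪ G v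
  boundary-∪⁅⁆ S v {w} w∈ with ∈-subsetOf⁻ (inBoundary? r (S ∪ ⁅ v ⁆)) w∈
  ... | w∉S∪v , enablers with LM.find enablers
  ... | Q , Q∈ , Q≠∅ , Q⊆S∪v with v ∈? Q
  ... | yes v∈Q = x∈p∪q⁺ (inj₂ (proj₂ (isRule w) Q Q∈ v v∈Q))
  ... | no  v∉Q = x∈p∪q⁺ (inj₁ (x∈p∧x≢y⇒x∈p-y w∈boundary w≢v))
    where
    Q⊆S : Q ⊆ S
    Q⊆S {u} u∈Q with x∈p∪q⁻ S ⁅ v ⁆ (Q⊆S∪v u∈Q)
    ... | inj₁ u∈S = u∈S
    ... | inj₂ u∈v = contradiction (subst (_∈ Q) (x∈⁅y⁆⇒x≡y v u∈v) u∈Q) v∉Q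
    w∈boundary : w ∈ boundaryOf r S
    w∈boundary = ∈-subsetOf⁺ (inBoundary? r S) ((λ w∈S → w∉S∪v (x∈p∪q⁺ (inj₁ w∈S))) , LM.lose Q∈ (Q≠∅ , Q⊆S))
    w≢v : w ≢ v
    w≢v refl = w∉S∪v (x∈p∪q⁺ (inj₂ (x∈⁅x⁆ v)))

module Greedy {n : ℕ} (r : Rule n) (Inv : Subset n → Set) (K : ℕ)
  (bounded : ∀ {S} → Inv S → ∣ boundaryOf r S ∣ ≤ K)
  (extend : ∀ {S} → Inv S → ∣ S ∣ < n → Σ (Fin n) λ v → v ∉ S × EnabledBy r S v × Inv (S ∪ ⁅ v ⁆))
  where

  record Run (S : Subset n) (k : ℕ) : Set where
    field
      walk      : List (Fin n)
      fresh     : All (_∉ S) walk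
      unique    : Unique walk
      enabled   : ∀ i → EnabledBy r (S ∪ setOf (take (toℕ i) walk)) (lookup walk i)
      invariant : ∀ i → Inv (S ∪ setOf (take i walk))
      length≡   : length walk ≡ k

  run : ∀ k {S} → Inv S → ∣ S ∣ + k ≡ n → Run S k
  run zero {S} inv _ = record
    { walk = [] ; fresh = [] ; unique = [] ; enabled = λ () ; invariant = invariant ; length≡ = refl }
    where
    invariant : ∀ i → Inv (S ∪ setOf (take i []))
    invariant zero    = subst Inv (sym (∪-identityʳ S)) inv
    invariant (suc _) = subst Inv (sym (∪-identityʳ S)) inv
  run (suc k) {S} inv ∣S∣+k+1≡n with extend inv (subst (∣ S ∣ <_) ∣S∣+k+1≡n (m<m+n ∣ S ∣ z<s))
  ... | v , v∉S , (Q , Q∈ , Q⊆S) , inv′ = record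
    { walk      = v ∷ walk
    ; fresh     = v∉S ∷ All.map ∉S∪v⇒∉S fresh
    ; unique    = All.map ∉S∪v⇒≢v fresh ∷ unique
    ; enabled   = enabled′
    ; invariant = invariant′
    ; length≡   = cong suc length≡
    }
    where
    open Run (run k inv′ (trans (cong (_+ k) (x∉p⇒∣p∪⁅x⁆∣≡1+∣p∣ v∉S)) (trans (sym (+-suc ∣ S ∣ k)) ∣S∣+k+1≡n)))
    ∉S∪v⇒∉S : ∀ {w} → w ∉ S ∪ ⁅ v ⁆ → w ∉ S
    ∉S∪v⇒∉S w∉ w∈S = w∉ (x∈p∪q⁺ (inj₁ w∈S))
    ∉S∪v⇒≢v : ∀ {w} → w ∉ S ∪ ⁅ v ⁆ → v ≢ w
    ∉S∪v⇒≢v w∉ refl = w∉ (x∈p∪q⁺ (inj₂ (x∈⁅x⁆ v)))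
    reassoc : ∀ xs → (S ∪ ⁅ v ⁆) ∪ setOf xs ≡ S ∪ setOf (v ∷ xs)
    reassoc xs = ∪-assoc S ⁅ v ⁆ (setOf xs)
    enabled′ : ∀ i → EnabledBy r (S ∪ setOf (take (toℕ i) (v ∷ walk))) (lookup (v ∷ walk) i)
    enabled′ Fin.zero    = Q , Q∈ , λ u∈Q → x∈p∪q⁺ (inj₁ (Q⊆S u∈Q))
    enabled′ (Fin.suc i) with enabled i
    ... | Q′ , Q′∈ , Q′⊆ = Q′ , Q′∈ , λ u∈Q′ → subst (_ ∈_) (reassoc (take (toℕ i) walk)) (Q′⊆ u∈Q′)
    invariant′ : ∀ i → Inv (S ∪ setOf (take i (v ∷ walk)))
    invariant′ zero    = subst Inv (sym (∪-identityʳ S)) inv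
    invariant′ (suc i) = subst Inv (reassoc (take i walk)) (invariant i)

  visit : Inv ⊥ → Σ (List (Fin n)) λ ψ → IsRVisit r ψ × bnum r ψ ≤ K
  visit inv = walk , ((unique , enabledFrom⊥) , length≡) ,
              foldr-⊔-map-≤ _ bounded-prefix (map suc (upTo (length walk)))
    where
    open Run (run n inv (cong (_+ n) (∣⊥∣≡0 n)))
    enabledFrom⊥ : ∀ i → EnabledBy r (setOf (take (toℕ i) walk)) (lookup walk i)
    enabledFrom⊥ i with enabled i
    ... | Q , Q∈ , Q⊆ = Q , Q∈ , λ u∈Q → subst (_ ∈_) (∪-identityˡ _) (Q⊆ u∈Q)
    bounded-prefix : ∀ i → ∣ boundary r (take i walk) ∣ ≤ K
    bounded-prefix i = bounded (subst Inv (∪-identityˡ _) (invariant i))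

module Layered {n : ℕ} (G : Graph n) (ℓ : ℕ) (pathsBounded : ∀ u v k → Path G u v k → k ≤ ℓ)
               (r : Rule n) (isRule : IsVisitRule G r) where

  open Height G ℓ pathsBounded

  c : ℕ
  c = maxOutDeg G ∸ 1

  budget : ℕ → ℕ
  budget t = suc (c * (ℓ ∸ t))

  Above : ℕ → Subset n
  Above t = subsetOf (λ w → t ≤? height w)

  Layered : Subset n → Set
  Layered S = ∀ t → ∣ boundaryOf r S ∩ Above t ∣ ≤ budget t

  outDeg≤1+c : ∀ v → ∣ G v ∣ ≤ suc c
  outDeg≤1+c v = ≤-trans (outDeg≤maxOutDeg G v) (m≤n+m∸n (maxOutDeg G) 1)

  ∈-Above⁺ : ∀ {t w} → t ≤ height w → w ∈ Above t
  ∈-Above⁺ {t} = ∈-subsetOf⁺ (λ w → t ≤? height w)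

  ∈-Above⁻ : ∀ {t w} → w ∈ Above t → t ≤ height w
  ∈-Above⁻ {t} = ∈-subsetOf⁻ (λ w → t ≤? height w)

  successors-below : ∀ {v t} → height v ≤ t → Empty (G v ∩ Above t)
  successors-below hv≤t (w , w∈) with x∈p∩q⁻ _ _ w∈
  ... | w∈Gv , w∈Above = <⇒≱ (height-edge w∈Gv) (≤-trans hv≤t (∈-Above⁻ w∈Above))

  boundary-in-layer : ∀ {S t} → Layered S → (∀ {w} → w ∈ boundaryOf r S → t ≤ height w) →
                      ∣ boundaryOf r S ∣ ≤ budget t
  boundary-in-layer {S} {t} layered high =
    ≤-trans (p⊆q⇒∣p∣≤∣q∣ {p = boundaryOf r S} (λ w∈ → x∈p∩q⁺ (w∈ , ∈-Above⁺ (high w∈)))) (layered t)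

  layered⇒bounded : ∀ {S} → Layered S → ∣ boundaryOf r S ∣ ≤ c * ℓ + 1
  layered⇒bounded layered = ≤-trans (boundary-in-layer layered (λ _ → z≤n)) (≤-reflexive (+-comm 1 (c * ℓ)))

  empty⇒layered : ∀ {S} → Empty (boundaryOf r S) → Layered S
  empty⇒layered {S} empty t =
    ≤-trans (∣p∩q∣≤∣p∣ (boundaryOf r S) (Above t)) (subst (_≤ budget t) (sym (∣Empty∣≡0 empty)) z≤n)

  layered-⊥ : Layered ⊥
  layered-⊥ = empty⇒layered (boundary-⊥ r)

  layered-∪-lowest : ∀ {S v} → Layered S → v ∈ boundaryOf r S →
                     (∀ {w} → w ∈ boundaryOf r S → height v ≤ height w) → Layered (S ∪ ⁅ v ⁆)
  layered-∪-lowest {S} {v} layered v∈ lowest t with height v ≤? t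
  ... | yes hv≤t = ≤-trans (p⊆q⇒∣p∣≤∣q∣ {p = boundaryOf r (S ∪ ⁅ v ⁆) ∩ Above t} unchanged) (layered t)
    where
    unchanged : boundaryOf r (S ∪ ⁅ v ⁆) ∩ Above t ⊆ boundaryOf r S ∩ Above t
    unchanged {w} w∈ with x∈p∩q⁻ _ _ w∈
    ... | w∈B , w∈Above with x∈p∪q⁻ _ _ (boundary-∪⁅⁆ isRule S v w∈B)
    ... | inj₁ w∈B-v = x∈p∩q⁺ (p─q⊆p _ _ w∈B-v , w∈Above)
    ... | inj₂ w∈Gv  = contradiction (w , x∈p∩q⁺ (w∈Gv , w∈Above)) (successors-below hv≤t)
  ... | no  hv≰t = begin
    ∣ boundaryOf r (S ∪ ⁅ v ⁆) ∩ Above t ∣   ≤⟨ p⊆q⇒∣p∣≤∣q∣ {p = boundaryOf r (S ∪ ⁅ v ⁆) ∩ Above t} (λ w∈ → boundary-∪⁅⁆ isRule S v (proj₁ (x∈p∩q⁻ _ _ w∈))) ⟩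
    ∣ (boundaryOf r S - v) ∪ G v ∣           ≤⟨ ∣p∪q∣≤∣p∣+∣q∣ (boundaryOf r S - v) (G v) ⟩
    ∣ boundaryOf r S - v ∣ + ∣ G v ∣         ≤⟨ +-mono-≤ rest (outDeg≤1+c v) ⟩
    c * (ℓ ∸ height v) + suc c               ≡⟨ +-comm (c * (ℓ ∸ height v)) (suc c) ⟩
    suc (c + c * (ℓ ∸ height v))             ≡⟨ cong suc (*-suc c (ℓ ∸ height v)) ⟨
    suc (c * suc (ℓ ∸ height v))             ≤⟨ s≤s (*-monoʳ-≤ c (∸-monoʳ-< (≰⇒> hv≰t) (height≤ℓ v))) ⟩
    suc (c * (ℓ ∸ t))                        ∎
    where
    open ≤-Reasoning
    rest : ∣ boundaryOf r S - v ∣ ≤ c * (ℓ ∸ height v)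
    rest = s≤s⁻¹ (<-≤-trans (x∈p⇒∣p-x∣<∣p∣ v∈) (boundary-in-layer layered lowest))

  layered-∪-fresh : ∀ {S v} → Empty (boundaryOf r S) → Layered (S ∪ ⁅ v ⁆)
  layered-∪-fresh {S} {v} empty t =
    ≤-trans (p⊆q⇒∣p∣≤∣q∣ {p = boundaryOf r (S ∪ ⁅ v ⁆) ∩ Above t} toSuccessors) successors≤budget
    where
    toSuccessors : boundaryOf r (S ∪ ⁅ v ⁆) ∩ Above t ⊆ G v ∩ Above t
    toSuccessors w∈ with x∈p∩q⁻ _ _ w∈
    ... | w∈B , w∈Above with x∈p∪q⁻ _ _ (boundary-∪⁅⁆ isRule S v w∈B)
    ... | inj₁ w∈B-v = contradiction (_ , p─q⊆p _ _ w∈B-v) empty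
    ... | inj₂ w∈Gv  = x∈p∩q⁺ (w∈Gv , w∈Above)
    successors≤budget : ∣ G v ∩ Above t ∣ ≤ budget t
    successors≤budget with height v ≤? t
    ... | yes hv≤t = subst (_≤ budget t) (sym (∣Empty∣≡0 (successors-below hv≤t))) z≤n
    ... | no  hv≰t = ≤-trans (∣p∩q∣≤∣p∣ (G v) (Above t)) (≤-trans (outDeg≤1+c v) (s≤s (m≤m*n c (ℓ ∸ t))))
      where instance
        _ = >-nonZero (m<n⇒0<n∸m (<-≤-trans (≰⇒> hv≰t) (height≤ℓ v)))

  highest-enabled : ∀ {S v} → v ∉ S → (∀ {w} → w ∉ S → ℓ ∸ height v ≤ ℓ ∸ height w) → EnabledBy r S v
  highest-enabled {S} {v} v∉S highest with r v | proj₁ (isRule v) | proj₂ (isRule v)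
  ... | []     | nonempty | _           = contradiction refl nonempty
  ... | Q ∷ Qs | _        | predecessor = Q , Any.here refl , Q⊆S
    where
    Q⊆S : Q ⊆ S
    Q⊆S {u} u∈Q with u ∈? S
    ... | yes u∈S = u∈S
    ... | no  u∉S = contradiction (highest u∉S)
                      (<⇒≱ (∸-monoʳ-< (height-edge (predecessor Q (Any.here refl) u u∈Q)) (height≤ℓ u)))

  extend : ∀ {S} → Layered S → ∣ S ∣ < n → Σ (Fin n) λ v → v ∉ S × EnabledBy r S v × Layered (S ∪ ⁅ v ⁆)
  extend {S} layered ∣S∣<n with nonempty? (boundaryOf r S)
  ... | yes (v₀ , v₀∈) =
    let v , v∈ , lowest = minimiser (_∈? boundaryOf r S) height v₀∈
        v∉S , enabled = boundary⇒enabled r v∈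
    in v , v∉S , enabled , layered-∪-lowest layered v∈ lowest
  ... | no empty =
    let u₀ , u₀∉S = ∣p∣<n⇒∃∉ S ∣S∣<n
        v , v∉S , highest = minimiser (λ w → ¬? (w ∈? S)) (λ w → ℓ ∸ height w) u₀∉S
    in v , v∉S , highest-enabled v∉S highest , layered-∪-fresh empty

theorem13 : ∀ {n} (G : Graph n) (ℓ : ℕ) → IsDAG G → IsDepth G ℓ →
    (r : Rule n) → IsVisitRule G r →
    Σ (List (Fin n)) λ ψ → IsRVisit r ψ × bnum r ψ ≤ (maxOutDeg G ∸ 1) * ℓ + 1
theorem13 G ℓ _ (pathsBounded , _) r isRule =
  Greedy.visit r Layered (c * ℓ + 1) layered⇒bounded extend layered-⊥
  where open Layered G ℓ pathsBounded r isRule
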